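{- Let $\mathcal{M}$ be the set of Motzkin meanders that contain neither $UU$ nor $DU$ as a contiguous subword, and let $S(u)=\sum_{w\in\mathcal{M}} z^{|w|}u^{\mathrm{level}(w)}$. Put $$W=\sqrt{1-2z+z^2-4z^3},\qquad r_1=\frac{1-z-W}{2z^2}.$$ Then $$S(u)=\frac{(1+uz^2)r_1-z}{z^2(1-uzr_1)}.$$
   Context: A Motzkin meander is a finite word $w$ over $\{U,H,D\}$ (heights $+1,0,-1$) all of whose prefixes have nonnegative height sum; $|w|$ is its length and $\mathrm{level}(w)$ its total height sum; the empty word is included; excursions are meanders of level $0$. "Contains $XY$ as a contiguous subword" means two consecutive letters are $X$ then $Y$. Generating functions are formal power series in $z$; $W$ is the formal power series square root with constant term $1$. -}

module Defs where

open import Data.Nat as ℕ using (ℕ; zero; suc; _∸_)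
open import Data.Integer as ℤ using (ℤ; +_; 0ℤ; 1ℤ)
open import Data.List using (List; []; _∷_; map; concatMap; length; filter; inits; zip; drop)
open import Data.List.Relation.Unary.All using (All; all?)
open import Data.List.Relation.Unary.Any using (Any; any?)
open import Data.Product using (_×_; _,_)
open import Relation.Nullary using (¬_; Dec; yes; no)
open import Relation.Nullary.Decidable using (_×-dec_; ¬?)
open import Relation.Binary.PropositionalEquality using (_≡_; refl)

data Step : Set where
  U H D : Step

_≟S_ : (a b : Step) → Dec (a ≡ b)
U ≟S U = yes refl
U ≟S H = no λ ()
U ≟S D = no λ ()
H ≟S U = no λ ()
H ≟S H = yes refl
H ≟S D = no λ ()
D ≟S U = no λ ()
D ≟S H = no λ ()
D ≟S D = yes refl

height : Step → ℤ
height U = + 1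
height H = 0ℤ
height D = ℤ.- (+ 1)

level : List Step → ℤ
level [] = 0ℤ
level (s ∷ w) = height s ℤ.+ level w

Meander : List Step → Set
Meander w = All (λ p → 0ℤ ℤ.≤ level p) (inits w)

ContainsPair : Step → Step → List Step → Set
ContainsPair X Y w = Any (λ p → p ≡ (X , Y)) (zip w (drop 1 w))

_≟P_ : (p q : Step × Step) → Dec (p ≡ q)
(a , b) ≟P (c , d) with a ≟S c | b ≟S d
... | yes refl | yes refl = yes refl
... | no ne | _ = no λ { refl → ne refl }
... | yes _ | no ne = no λ { refl → ne refl }

InM : List Step → Set
InM w = Meander w × ¬ ContainsPair U U w × ¬ ContainsPair D U w

InMLevel : ℕ → List Step → Set
InMLevel k w = InM w × level w ≡ + k

inMLevel? : (k : ℕ) (w : List Step) → Dec (InMLevel k w)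
inMLevel? k w =
  ((all? (λ p → 0ℤ ℤ.≤? level p) (inits w))
    ×-dec (¬? (any? (λ p → p ≟P (U , U)) (zip w (drop 1 w))))
    ×-dec (¬? (any? (λ p → p ≟P (D , U)) (zip w (drop 1 w)))))
  ×-dec (level w ℤ.≟ + k)

words : ℕ → List (List Step)
words zero = [] ∷ []
words (suc n) = concatMap (λ s → map (s ∷_) (words n)) (U ∷ H ∷ D ∷ [])

Ser1 : Set
Ser1 = ℕ → ℤ

-- bivariate series in z,u : coefficient of z^n u^k
Ser2 : Set
Ser2 = ℕ → ℕ → ℤ

sumTo : ℕ → (ℕ → ℤ) → ℤ
sumTo zero f = f 0
sumTo (suc n) f = sumTo n f ℤ.+ f (suc n)

infixl 6 _+₁_ _-₁_
infixl 7 _*₁_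
infix 4 _≈₁_

const₁ : ℤ → Ser1
const₁ a zero = a
const₁ a (suc n) = 0ℤ

z₁ : Ser1
z₁ 1 = 1ℤ
z₁ _ = 0ℤ

_+₁_ _-₁_ _*₁_ : Ser1 → Ser1 → Ser1
(f +₁ g) n = f n ℤ.+ g n
(f -₁ g) n = f n ℤ.- g n
(f *₁ g) n = sumTo n (λ i → f i ℤ.* g (n ∸ i))

_≈₁_ : Ser1 → Ser1 → Set
f ≈₁ g = ∀ n → f n ≡ g n

infixl 6 _+₂_ _-₂_
infixl 7 _*₂_
infix 4 _≈₂_

lift : Ser1 → Ser2
lift f n zero = f n
lift f n (suc k) = 0ℤ

one₂ : Ser2
one₂ = lift (const₁ 1ℤ)

z₂ : Ser2
z₂ = lift z₁

u₂ : Ser2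
u₂ zero 1 = 1ℤ
u₂ _ _ = 0ℤ

_+₂_ _-₂_ _*₂_ : Ser2 → Ser2 → Ser2
(f +₂ g) n k = f n k ℤ.+ g n k
(f -₂ g) n k = f n k ℤ.- g n k
(f *₂ g) n k = sumTo n (λ i → sumTo k (λ j → f i j ℤ.* g (n ∸ i) (k ∸ j)))

_≈₂_ : Ser2 → Ser2 → Set
f ≈₂ g = ∀ n k → f n k ≡ g n k

S : Ser2
S n k = + length (filter (inMLevel? k) (words n))

P : Ser1
P = const₁ 1ℤ -₁ const₁ (+ 2) *₁ z₁ +₁ z₁ *₁ z₁ -₁ const₁ (+ 4) *₁ z₁ *₁ z₁ *₁ z₁

{-# OPTIONS --safe #-}
module Submission where

-- A word avoids UU and DU exactly when each of its U's is its first letter or follows an H.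
-- So 𝓜 is recognised by an automaton whose states are the current height together with
-- whether a U may be read next, and the numbers of words of length n ending in each state
-- obey linear recurrences in n.  These are solved in ℤ[[z]] through the root r of
-- r = z + z r + z² r², which the hypotheses on W and r₁ force r₁ to be: with E = (r − z)/z²,
-- the words of level 0 have generating function E, those of level 1 have r + z r E, and each
-- further level multiplies by z r.  Hence the coefficients of u⁰, u¹ and u^(k+2) in
-- (1 − u z r) S are E, r and 0, that is z² (1 − u z r) S = (1 + u z²) r − z.
-- The root exists because iterating r ↦ z + z r + z² r² from 0 fixes one more coefficient
-- at each step.

open import Defs
open import Data.Bool using (Bool; true; false)
open import Data.Bool.Properties using (T-≡)
open import Data.Empty using (⊥; ⊥-elim)
open import Data.Unit using (⊤; tt)
open import Data.Nat as ℕ using (ℕ; zero; suc; _∸_; _≤_; _<_; z≤n; s≤s)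
import Data.Nat.Properties as ℕP
open import Data.Nat.ListAction using (sum)
open import Data.Nat.ListAction.Properties using (sum-++)
open import Data.Integer as ℤ using (ℤ; +_; 0ℤ; 1ℤ)
import Data.Integer.Properties as ℤP
open import Data.Integer.Solver using (module +-*-Solver)
open import Data.List using (List; []; _∷_; _++_; [_]; map; concatMap; filter; length; inits)
open import Data.List.Properties using (map-++; map-cong; map-∘)
open import Data.List.Relation.Unary.All as All using (All; []; _∷_)
import Data.List.Relation.Unary.All.Properties as All
open import Data.List.Relation.Unary.Any using (here; there)
open import Data.Maybe using (Maybe; just; nothing)
open import Data.Product using (Σ; _×_; _,_; proj₁; proj₂)
open import Data.Sum using (_⊎_; inj₁; inj₂)
open import Function using (_⇔_; mk⇔; Equivalence)
open import Relation.Nullary using (¬_; Dec; yes; no; does)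
open import Relation.Unary using (Decidable)
open import Relation.Binary.PropositionalEquality hiding ([_])
open import Algebra.Structures using (IsCommutativeSemiring)
open import Algebra.Solver.Ring.AlmostCommutativeRing
  using (AlmostCommutativeRing; _-Raw-AlmostCommutative⟶_; module AlmostCommutativeRing)
import Algebra.Solver.Ring
import Algebra.Properties.CommutativeSemigroup ℕP.+-commutativeSemigroup as ℕInterchange
open import Algebra.Properties.CommutativeSemigroup ℤP.+-commutativeSemigroup using (interchange)
open import Algebra.Properties.AbelianGroup ℤP.+-0-abelianGroup using (identityʳ-unique)
import Relation.Binary.Reasoning.Setoid as SetoidReasoning

sumTo-cong : ∀ n {f g : ℕ → ℤ} → (∀ i → f i ≡ g i) → sumTo n f ≡ sumTo n g
sumTo-cong zero    f≡g = f≡g 0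
sumTo-cong (suc n) f≡g = cong₂ ℤ._+_ (sumTo-cong n f≡g) (f≡g (suc n))

sumTo-congᵇ : ∀ n {f g : ℕ → ℤ} → (∀ i → i ≤ n → f i ≡ g i) → sumTo n f ≡ sumTo n g
sumTo-congᵇ zero    f≡g = f≡g 0 z≤n
sumTo-congᵇ (suc n) f≡g =
  cong₂ ℤ._+_ (sumTo-congᵇ n (λ i i≤n → f≡g i (ℕP.m≤n⇒m≤1+n i≤n))) (f≡g (suc n) ℕP.≤-refl)

sumTo-+ : ∀ n (f g : ℕ → ℤ) → sumTo n (λ i → f i ℤ.+ g i) ≡ sumTo n f ℤ.+ sumTo n g
sumTo-+ zero    f g = refl
sumTo-+ (suc n) f g = trans (cong (ℤ._+ (f (suc n) ℤ.+ g (suc n))) (sumTo-+ n f g))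
                            (interchange (sumTo n f) (sumTo n g) (f (suc n)) (g (suc n)))

sumTo-*ˡ : ∀ n a (f : ℕ → ℤ) → sumTo n (λ i → a ℤ.* f i) ≡ a ℤ.* sumTo n f
sumTo-*ˡ zero    a f = refl
sumTo-*ˡ (suc n) a f = trans (cong (ℤ._+ a ℤ.* f (suc n)) (sumTo-*ˡ n a f))
                             (sym (ℤP.*-distribˡ-+ a (sumTo n f) (f (suc n))))

sumTo-neg : ∀ n (f : ℕ → ℤ) → sumTo n (λ i → ℤ.- f i) ≡ ℤ.- sumTo n f
sumTo-neg zero    f = refl
sumTo-neg (suc n) f = trans (cong (ℤ._+ ℤ.- f (suc n)) (sumTo-neg n f))
                            (sym (ℤP.neg-distrib-+ (sumTo n f) (f (suc n))))

sumTo-zero : ∀ n {f : ℕ → ℤ} → (∀ i → f i ≡ 0ℤ) → sumTo n f ≡ 0ℤ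
sumTo-zero zero    f≡0 = f≡0 0
sumTo-zero (suc n) f≡0 = cong₂ ℤ._+_ (sumTo-zero n f≡0) (f≡0 (suc n))

sumTo-sucˡ : ∀ n (f : ℕ → ℤ) → sumTo (suc n) f ≡ f 0 ℤ.+ sumTo n (λ i → f (suc i))
sumTo-sucˡ zero    f = refl
sumTo-sucˡ (suc n) f = trans (cong (ℤ._+ f (suc (suc n))) (sumTo-sucˡ n f))
                             (ℤP.+-assoc (f 0) _ _)

sumTo-reverse : ∀ n (f : ℕ → ℤ) → sumTo n (λ i → f (n ∸ i)) ≡ sumTo n f
sumTo-reverse zero    f = refl
sumTo-reverse (suc n) f = begin
  sumTo (suc n) (λ i → f (suc n ∸ i))      ≡⟨ sumTo-sucˡ n (λ i → f (suc n ∸ i)) ⟩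
  f (suc n) ℤ.+ sumTo n (λ i → f (n ∸ i))  ≡⟨ cong (λ x → f (suc n) ℤ.+ x) (sumTo-reverse n f) ⟩
  f (suc n) ℤ.+ sumTo n f                  ≡⟨ ℤP.+-comm (f (suc n)) _ ⟩
  sumTo (suc n) f                          ∎
  where open ≡-Reasoning

sumTo-swap : ∀ m n (h : ℕ → ℕ → ℤ) →
             sumTo m (λ i → sumTo n (h i)) ≡ sumTo n (λ j → sumTo m (λ i → h i j))
sumTo-swap zero    n h = refl
sumTo-swap (suc m) n h = trans (cong (ℤ._+ sumTo n (h (suc m))) (sumTo-swap m n h))
                               (sym (sumTo-+ n _ _))

-- The ring ℤ[[z]]

infix 8 neg₁_

0₁ 1₁ : Ser1
0₁ = const₁ 0ℤ
1₁ = const₁ 1ℤ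

neg₁_ : Ser1 → Ser1
(neg₁ f) n = ℤ.- f n

scale : ℤ → Ser1 → Ser1
scale a f n = a ℤ.* f n

shift : Ser1 → Ser1
shift f n = f (suc n)

0₁-coeff : ∀ n → 0₁ n ≡ 0ℤ
0₁-coeff zero    = refl
0₁-coeff (suc n) = refl

*₁-suc : ∀ f g n → (f *₁ g) (suc n) ≡ f 0 ℤ.* g (suc n) ℤ.+ (shift f *₁ g) n
*₁-suc f g n = sumTo-sucˡ n (λ i → f i ℤ.* g (suc n ∸ i))

*₁-cong : ∀ {f f′ g g′} → f ≈₁ f′ → g ≈₁ g′ → f *₁ g ≈₁ f′ *₁ g′
*₁-cong f≈ g≈ n = sumTo-cong n (λ i → cong₂ ℤ._*_ (f≈ i) (g≈ (n ∸ i)))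

+₁-cong : ∀ {f f′ g g′} → f ≈₁ f′ → g ≈₁ g′ → f +₁ g ≈₁ f′ +₁ g′
+₁-cong f≈ g≈ n = cong₂ ℤ._+_ (f≈ n) (g≈ n)

-₁-cong : ∀ {f f′ g g′} → f ≈₁ f′ → g ≈₁ g′ → f -₁ g ≈₁ f′ -₁ g′
-₁-cong f≈ g≈ n = cong₂ ℤ._-_ (f≈ n) (g≈ n)

*₁-vanishesˡ : ∀ {f} g → (∀ i → f i ≡ 0ℤ) → ∀ n → (f *₁ g) n ≡ 0ℤ
*₁-vanishesˡ {f} g f≡0 n =
  sumTo-zero n (λ i → trans (cong (ℤ._* g (n ∸ i)) (f≡0 i)) (ℤP.*-zeroˡ (g (n ∸ i))))

*₁-vanishesʳ : ∀ f {g} → (∀ i → g i ≡ 0ℤ) → ∀ n → (f *₁ g) n ≡ 0ℤ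
*₁-vanishesʳ f {g} g≡0 n =
  sumTo-zero n (λ i → trans (cong (f i ℤ.*_) (g≡0 (n ∸ i))) (ℤP.*-zeroʳ (f i)))

*₁-comm : ∀ f g → f *₁ g ≈₁ g *₁ f
*₁-comm f g n = begin
  sumTo n (λ i → f i ℤ.* g (n ∸ i))                  ≡⟨ sym (sumTo-reverse n _) ⟩
  sumTo n (λ i → f (n ∸ i) ℤ.* g (n ∸ (n ∸ i)))      ≡⟨ sumTo-congᵇ n swapped ⟩
  sumTo n (λ i → g i ℤ.* f (n ∸ i))                  ∎
  where
  open ≡-Reasoning
  swapped : ∀ i → i ≤ n → f (n ∸ i) ℤ.* g (n ∸ (n ∸ i)) ≡ g i ℤ.* f (n ∸ i)
  swapped i i≤n = trans (cong (λ j → f (n ∸ i) ℤ.* g j) (ℕP.m∸[m∸n]≡n i≤n))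
                        (ℤP.*-comm (f (n ∸ i)) (g i))

*₁-distribˡ : ∀ f g h → f *₁ (g +₁ h) ≈₁ f *₁ g +₁ f *₁ h
*₁-distribˡ f g h n =
  trans (sumTo-cong n (λ i → ℤP.*-distribˡ-+ (f i) (g (n ∸ i)) (h (n ∸ i)))) (sumTo-+ n _ _)

*₁-distribʳ : ∀ f g h → (g +₁ h) *₁ f ≈₁ g *₁ f +₁ h *₁ f
*₁-distribʳ f g h n =
  trans (sumTo-cong n (λ i → ℤP.*-distribʳ-+ (f (n ∸ i)) (g i) (h i))) (sumTo-+ n _ _)

*₁-scaleˡ : ∀ a f g → scale a f *₁ g ≈₁ scale a (f *₁ g)
*₁-scaleˡ a f g n =
  trans (sumTo-cong n (λ i → ℤP.*-assoc a (f i) (g (n ∸ i)))) (sumTo-*ˡ n a _)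

*₁-negˡ : ∀ f g → neg₁ f *₁ g ≈₁ neg₁ (f *₁ g)
*₁-negˡ f g n =
  trans (sumTo-cong n (λ i → sym (ℤP.neg-distribˡ-* (f i) (g (n ∸ i))))) (sumTo-neg n _)

*₁-zeroˡ : ∀ f → 0₁ *₁ f ≈₁ 0₁
*₁-zeroˡ f n = trans (*₁-vanishesˡ f 0₁-coeff n) (sym (0₁-coeff n))

*₁-zeroʳ : ∀ f → f *₁ 0₁ ≈₁ 0₁
*₁-zeroʳ f n = trans (*₁-vanishesʳ f 0₁-coeff n) (sym (0₁-coeff n))

*₁-identityˡ : ∀ f → 1₁ *₁ f ≈₁ f
*₁-identityˡ f zero    = ℤP.*-identityˡ (f 0)
*₁-identityˡ f (suc n) = begin
  (1₁ *₁ f) (suc n)                         ≡⟨ *₁-suc 1₁ f n ⟩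
  1ℤ ℤ.* f (suc n) ℤ.+ (shift 1₁ *₁ f) n    ≡⟨ cong₂ ℤ._+_ (ℤP.*-identityˡ (f (suc n)))
                                                           (*₁-vanishesˡ f (λ _ → refl) n) ⟩
  f (suc n) ℤ.+ 0ℤ                          ≡⟨ ℤP.+-identityʳ _ ⟩
  f (suc n)                                 ∎
  where open ≡-Reasoning

*₁-identityʳ : ∀ f → f *₁ 1₁ ≈₁ f
*₁-identityʳ f n = trans (*₁-comm f 1₁ n) (*₁-identityˡ f n)

shift-*₁ : ∀ f g → shift (f *₁ g) ≈₁ scale (f 0) (shift g) +₁ shift f *₁ g
shift-*₁ f g = *₁-suc f g

*₁-assoc : ∀ f g h → (f *₁ g) *₁ h ≈₁ f *₁ (g *₁ h)
*₁-assoc f g h zero    = ℤP.*-assoc (f 0) (g 0) (h 0)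
*₁-assoc f g h (suc n) = begin
  ((f *₁ g) *₁ h) (suc n)
    ≡⟨ *₁-suc (f *₁ g) h n ⟩
  f₀ ℤ.* g₀ ℤ.* h (suc n) ℤ.+ (shift (f *₁ g) *₁ h) n
    ≡⟨ cong (λ x → f₀ ℤ.* g₀ ℤ.* h (suc n) ℤ.+ x) (begin
         (shift (f *₁ g) *₁ h) n
           ≡⟨ *₁-cong {g = h} (shift-*₁ f g) (λ _ → refl) n ⟩
         ((scale f₀ (shift g) +₁ shift f *₁ g) *₁ h) n
           ≡⟨ *₁-distribʳ h (scale f₀ (shift g)) (shift f *₁ g) n ⟩
         (scale f₀ (shift g) *₁ h) n ℤ.+ ((shift f *₁ g) *₁ h) n
           ≡⟨ cong₂ ℤ._+_ (*₁-scaleˡ f₀ (shift g) h n) (*₁-assoc (shift f) g h n) ⟩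
         f₀ ℤ.* (shift g *₁ h) n ℤ.+ (shift f *₁ (g *₁ h)) n ∎) ⟩
  f₀ ℤ.* g₀ ℤ.* h (suc n) ℤ.+ (f₀ ℤ.* (shift g *₁ h) n ℤ.+ (shift f *₁ (g *₁ h)) n)
    ≡⟨ regroup f₀ g₀ (h (suc n)) ((shift g *₁ h) n) ((shift f *₁ (g *₁ h)) n) ⟩
  f₀ ℤ.* (g₀ ℤ.* h (suc n) ℤ.+ (shift g *₁ h) n) ℤ.+ (shift f *₁ (g *₁ h)) n
    ≡⟨ cong (λ x → f₀ ℤ.* x ℤ.+ (shift f *₁ (g *₁ h)) n) (sym (*₁-suc g h n)) ⟩
  f₀ ℤ.* (g *₁ h) (suc n) ℤ.+ (shift f *₁ (g *₁ h)) n
    ≡⟨ sym (*₁-suc f (g *₁ h) n) ⟩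
  (f *₁ (g *₁ h)) (suc n) ∎
  where
  open ≡-Reasoning
  open +-*-Solver
  f₀ = f 0
  g₀ = g 0
  regroup : ∀ a b c d e → a ℤ.* b ℤ.* c ℤ.+ (a ℤ.* d ℤ.+ e) ≡ a ℤ.* (b ℤ.* c ℤ.+ d) ℤ.+ e
  regroup = solve 5 (λ a b c d e → a :* b :* c :+ (a :* d :+ e) := a :* (b :* c :+ d) :+ e) refl

ser-isCommutativeSemiring : IsCommutativeSemiring _≈₁_ _+₁_ _*₁_ 0₁ 1₁
ser-isCommutativeSemiring = record
  { isSemiring = record
    { isSemiringWithoutAnnihilatingZero = record
      { +-isCommutativeMonoid = record
        { isMonoid = record
          { isSemigroup = record
            { isMagma = record
              { isEquivalence = record
                { refl = λ _ → refl ; sym = λ f≈g n → sym (f≈g n)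
                ; trans = λ f≈g g≈h n → trans (f≈g n) (g≈h n) }
              ; ∙-cong = +₁-cong }
            ; assoc = λ f g h n → ℤP.+-assoc (f n) (g n) (h n) }
          ; identity = (λ f n → trans (cong (ℤ._+ f n) (0₁-coeff n)) (ℤP.+-identityˡ (f n)))
                     , (λ f n → trans (cong (λ x → f n ℤ.+ x) (0₁-coeff n)) (ℤP.+-identityʳ (f n))) }
        ; comm = λ f g n → ℤP.+-comm (f n) (g n) }
      ; *-cong = *₁-cong
      ; *-assoc = *₁-assoc
      ; *-identity = *₁-identityˡ , *₁-identityʳ
      ; distrib = *₁-distribˡ , *₁-distribʳ }
    ; zero = *₁-zeroˡ , *₁-zeroʳ }
  ; *-comm = *₁-comm }

ser-almostCommutativeRing : AlmostCommutativeRing _ _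
ser-almostCommutativeRing = record
  { Carrier = Ser1 ; _≈_ = _≈₁_ ; _+_ = _+₁_ ; _*_ = _*₁_ ; -_ = neg₁_ ; 0# = 0₁ ; 1# = 1₁
  ; isAlmostCommutativeRing = record
    { isCommutativeSemiring = ser-isCommutativeSemiring
    ; -‿cong = λ f≈g n → cong ℤ.-_ (f≈g n)
    ; -‿*-distribˡ = *₁-negˡ
    ; -‿+-comm = λ f g n → sym (ℤP.neg-distrib-+ (f n) (g n)) } }

const₁-homomorphism : ℤ.+-*-rawRing -Raw-AlmostCommutative⟶ ser-almostCommutativeRing
const₁-homomorphism = record
  { ⟦_⟧ = const₁
  ; +-homo = λ { a b zero → refl ; a b (suc n) → refl }
  ; *-homo = *-homo
  ; -‿homo = λ { a zero → refl ; a (suc n) → refl }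
  ; 0-homo = λ _ → refl
  ; 1-homo = λ _ → refl }
  where
  *-homo : ∀ a b → const₁ (a ℤ.* b) ≈₁ const₁ a *₁ const₁ b
  *-homo a b zero    = refl
  *-homo a b (suc n) = sym (begin
    (const₁ a *₁ const₁ b) (suc n)                         ≡⟨ *₁-suc (const₁ a) (const₁ b) n ⟩
    a ℤ.* 0ℤ ℤ.+ (shift (const₁ a) *₁ const₁ b) n          ≡⟨ cong₂ ℤ._+_ (ℤP.*-zeroʳ a)
                                                                (*₁-vanishesˡ (const₁ b) (λ _ → refl) n) ⟩
    0ℤ                                                     ∎)
    where open ≡-Reasoning

const₁-≟ : ∀ a b → Maybe (const₁ a ≈₁ const₁ b)
const₁-≟ a b with a ℤ.≟ b
... | yes refl = just (λ _ → refl)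
... | no  _    = nothing

module SerSolver = Algebra.Solver.Ring ℤ.+-*-rawRing ser-almostCommutativeRing const₁-homomorphism const₁-≟

open SerSolver using (solve; _:=_; _:+_; _:*_; _:-_; :-_; con)

z*₁-suc : ∀ f n → (z₁ *₁ f) (suc n) ≡ f n
z*₁-suc f n = trans (*₁-suc z₁ f n)
  (trans (ℤP.+-identityˡ _) (trans (*₁-cong {g = f} shift-z₁ (λ _ → refl) n) (*₁-identityˡ f n)))
  where
  shift-z₁ : shift z₁ ≈₁ 1₁
  shift-z₁ zero    = refl
  shift-z₁ (suc n) = refl

z*₁-cancel : ∀ {f g} → z₁ *₁ f ≈₁ z₁ *₁ g → f ≈₁ g
z*₁-cancel {f} {g} zf≈zg n = trans (sym (z*₁-suc f n)) (trans (zf≈zg (suc n)) (z*₁-suc g n))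

const*₁-coeff : ∀ c f n → (const₁ c *₁ f) n ≡ c ℤ.* f n
const*₁-coeff c f zero    = refl
const*₁-coeff c f (suc n) = trans (*₁-suc (const₁ c) f n)
  (trans (cong (λ x → c ℤ.* f (suc n) ℤ.+ x) (*₁-vanishesˡ f (λ _ → refl) n)) (ℤP.+-identityʳ _))

-- Lets a hypothesis X ≈ Y enter an identity checked by the ring solver.
≈₁-modulo : ∀ {A B} C {X Y} → X ≈₁ Y → A ≈₁ B +₁ C *₁ (X -₁ Y) → A ≈₁ B
≈₁-modulo {A} {B} C {X} {Y} X≈Y A≈ n = trans (A≈ n)
  (trans (cong (λ x → B n ℤ.+ x) (*₁-vanishesʳ C X-Y≡0 n)) (ℤP.+-identityʳ (B n)))
  where
  X-Y≡0 : ∀ m → (X -₁ Y) m ≡ 0ℤ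
  X-Y≡0 m = trans (cong (λ y → X m ℤ.- y) (sym (X≈Y m))) (ℤP.+-inverseʳ (X m))

-- The quadratic equation r = z + z r + z² r²

Φ : Ser1 → Ser1
Φ r = z₁ +₁ z₁ *₁ r +₁ z₁ *₁ (z₁ *₁ (r *₁ r))

AgreeBelow : ℕ → Ser1 → Ser1 → Set
AgreeBelow n f g = ∀ i → i < n → f i ≡ g i

agree-+ : ∀ {n f g f′ g′} → AgreeBelow n f g → AgreeBelow n f′ g′ → AgreeBelow n (f +₁ f′) (g +₁ g′)
agree-+ f≈g f′≈g′ i i<n = cong₂ ℤ._+_ (f≈g i i<n) (f′≈g′ i i<n)

agree-* : ∀ {n f g f′ g′} → AgreeBelow n f g → AgreeBelow n f′ g′ → AgreeBelow n (f *₁ f′) (g *₁ g′)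
agree-* f≈g f′≈g′ i i<n = sumTo-congᵇ i (λ j j≤i →
  cong₂ ℤ._*_ (f≈g j (ℕP.≤-<-trans j≤i i<n)) (f′≈g′ (i ∸ j) (ℕP.≤-<-trans (ℕP.m∸n≤m i j) i<n)))

agree-z* : ∀ {n f g} → AgreeBelow n f g → AgreeBelow (suc n) (z₁ *₁ f) (z₁ *₁ g)
agree-z* f≈g zero    _         = refl
agree-z* {f = f} {g} f≈g (suc i) (s≤s i<n) = trans (z*₁-suc f i) (trans (f≈g i i<n) (sym (z*₁-suc g i)))

agree-weaken : ∀ {n f g} → AgreeBelow (suc n) f g → AgreeBelow n f g
agree-weaken f≈g i i<n = f≈g i (ℕP.m≤n⇒m≤1+n i<n)

Φ-agree : ∀ {n f g} → AgreeBelow n f g → AgreeBelow (suc n) (Φ f) (Φ g)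
Φ-agree f≈g = agree-+ (agree-+ {f = z₁} {g = z₁} (λ _ _ → refl) (agree-z* f≈g))
                      (agree-z* (agree-weaken (agree-z* (agree-* f≈g f≈g))))

Φ-iterate : ℕ → Ser1
Φ-iterate zero    = 0₁
Φ-iterate (suc m) = Φ (Φ-iterate m)

Φ-iterate-agree : ∀ m → AgreeBelow m (Φ-iterate m) (Φ-iterate (suc m))
Φ-iterate-agree zero    i ()
Φ-iterate-agree (suc m) = Φ-agree (Φ-iterate-agree m)

Φ-iterate-stable : ∀ d i → Φ-iterate (d ℕ.+ suc i) i ≡ Φ-iterate (suc i) i
Φ-iterate-stable zero    i = refl
Φ-iterate-stable (suc d) i =
  trans (sym (Φ-iterate-agree (d ℕ.+ suc i) i (ℕP.m≤n+m (suc i) d))) (Φ-iterate-stable d i)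

Φ-root : Ser1
Φ-root n = Φ-iterate (suc n) n

Φ-root-fixed : Φ Φ-root ≈₁ Φ-root
Φ-root-fixed n = sym (Φ-agree iterate≈root n ℕP.≤-refl)
  where
  iterate≈root : AgreeBelow n (Φ-iterate n) Φ-root
  iterate≈root i i<n =
    trans (cong (λ m → Φ-iterate m i) (sym (ℕP.m∸n+n≡m i<n))) (Φ-iterate-stable (n ∸ suc i) i)

W-of : Ser1 → Ser1
W-of r = 1₁ -₁ z₁ -₁ const₁ (+ 2) *₁ z₁ *₁ z₁ *₁ r

W-of-square : ∀ r → W-of r *₁ W-of r ≈₁ P +₁ (const₁ (+ 4) *₁ z₁ *₁ z₁) *₁ (Φ r -₁ r)
W-of-square = solve 2 (λ z r →
  (con 1ℤ :- z :- con (+ 2) :* z :* z :* r) :* (con 1ℤ :- z :- con (+ 2) :* z :* z :* r)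
    := (con 1ℤ :- con (+ 2) :* z :+ z :* z :- con (+ 4) :* z :* z :* z)
       :+ (con (+ 4) :* z :* z) :* ((z :+ z :* r :+ z :* (z :* (r :* r))) :- r)) (λ _ → refl) z₁

W-of-relation : ∀ r → const₁ (+ 2) *₁ z₁ *₁ z₁ *₁ r ≈₁ const₁ 1ℤ -₁ z₁ -₁ W-of r
W-of-relation = solve 2 (λ z r →
  con (+ 2) :* z :* z :* r := con 1ℤ :- z :- (con 1ℤ :- z :- con (+ 2) :* z :* z :* r)) (λ _ → refl) z₁

W≈W-of : ∀ W r → const₁ (+ 2) *₁ z₁ *₁ z₁ *₁ r ≈₁ const₁ 1ℤ -₁ z₁ -₁ W → W ≈₁ W-of r
W≈W-of W r 2z²r≈ n = trans
  (solve 2 (λ z w → w := con 1ℤ :- z :- (con 1ℤ :- z :- w)) (λ _ → refl) z₁ W n)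
  (cong (λ x → (1₁ -₁ z₁) n ℤ.- x) (sym (2z²r≈ n)))

W-and-r₁-exist : Σ Ser1 λ W → (W 0 ≡ 1ℤ) × (W *₁ W ≈₁ P)
           × (Σ Ser1 λ r₁ → const₁ (+ 2) *₁ z₁ *₁ z₁ *₁ r₁ ≈₁ const₁ 1ℤ -₁ z₁ -₁ W)
W-and-r₁-exist = W-of Φ-root , refl
       , ≈₁-modulo (const₁ (+ 4) *₁ z₁ *₁ z₁) Φ-root-fixed (W-of-square Φ-root)
       , Φ-root , W-of-relation Φ-root

W²≈P⇒Φ-fixed : ∀ W r → W *₁ W ≈₁ P → const₁ (+ 2) *₁ z₁ *₁ z₁ *₁ r ≈₁ const₁ 1ℤ -₁ z₁ -₁ W → Φ r ≈₁ r
W²≈P⇒Φ-fixed W r W²≈P 2z²r≈ n = ℤP.i-j≡0⇒i≡j (Φ r n) (r n) (X≡0 n)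
  where
  X = Φ r -₁ r
  P≈P+4z²X : P ≈₁ P +₁ (const₁ (+ 4) *₁ z₁ *₁ z₁) *₁ X
  P≈P+4z²X m = trans (sym (W²≈P m)) (trans (*₁-cong W≈ W≈ m) (W-of-square r m))
    where W≈ = W≈W-of W r 2z²r≈
  4z²X≡0 : ∀ m → (const₁ (+ 4) *₁ (z₁ *₁ (z₁ *₁ X))) m ≡ 0ℤ
  4z²X≡0 m = trans
    (solve 2 (λ z x → con (+ 4) :* (z :* (z :* x)) := con (+ 4) :* z :* z :* x) (λ _ → refl) z₁ X m)
    (identityʳ-unique (P m) _ (sym (P≈P+4z²X m)))
  z²X≡0 : ∀ m → (z₁ *₁ (z₁ *₁ X)) m ≡ 0ℤ
  z²X≡0 m = ℤP.*-cancelˡ-≡ (+ 4) _ 0ℤ (trans (sym (const*₁-coeff (+ 4) (z₁ *₁ (z₁ *₁ X)) m)) (4z²X≡0 m))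
  X≡0 : ∀ m → X m ≡ 0ℤ
  X≡0 m = trans (sym (z*₁-suc X m)) (trans (sym (z*₁-suc (z₁ *₁ X) (suc m))) (z²X≡0 (suc (suc m))))

-- The automaton recognising 𝓜

-- blocked: the last letter was U or D, so reading U would create UU or DU.
data Mode : Set where
  free blocked : Mode

data State : Set where
  dead : State
  at   : ℕ → Mode → State

step : State → Step → State
step dead        _ = dead
step (at h c)    H = at h free
step (at zero c) D = dead
step (at (suc h) c) D = at h blocked
step (at h free)    U = at (suc h) blocked
step (at h blocked) U = dead

run : State → List Step → State
run s []      = s
run s (x ∷ w) = run (step s x) w

run-dead : ∀ w → run dead w ≡ dead
run-dead []      = refl
run-dead (x ∷ w) = run-dead w

run-snoc : ∀ s w x → run s (w ++ [ x ]) ≡ step (run s w) x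
run-snoc s []      x = refl
run-snoc s (y ∷ w) x = run-snoc (step s y) w x

step-height : ∀ {h c x h₁ c₁} → step (at h c) x ≡ at h₁ c₁ → + h ℤ.+ height x ≡ + h₁
step-height {h} {x = H}       refl = ℤP.+-identityʳ (+ h)
step-height {suc h} {x = D}   refl = refl
step-height {h} {free} {U}    refl = ℤP.+-comm (+ h) (+ 1)

MeanderFrom : ℕ → List Step → Set
MeanderFrom h w = All (λ p → 0ℤ ℤ.≤ + h ℤ.+ level p) (inits w)

meanderFrom-[] : ∀ h → MeanderFrom h []
meanderFrom-[] h = ℤ.+≤+ ℕ.z≤n ∷ []

meanderFrom-∷⁺ : ∀ {h x h₁ w} → + h ℤ.+ height x ≡ + h₁ → MeanderFrom h₁ w → MeanderFrom h (x ∷ w)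
meanderFrom-∷⁺ {h} {x} e m = ℤ.+≤+ ℕ.z≤n ∷ All.map⁺ (All.map (λ {p} → subst (0ℤ ℤ.≤_)
  (trans (cong (ℤ._+ level p) (sym e)) (ℤP.+-assoc (+ h) (height x) (level p)))) m)

meanderFrom-∷⁻ : ∀ {h x h₁ w} → + h ℤ.+ height x ≡ + h₁ → MeanderFrom h (x ∷ w) → MeanderFrom h₁ w
meanderFrom-∷⁻ {h} {x} e (_ ∷ m) = All.map (λ {p} → subst (0ℤ ℤ.≤_)
  (trans (sym (ℤP.+-assoc (+ h) (height x) (level p))) (cong (ℤ._+ level p) e))) (All.map⁻ m)

meanderFrom0⇔meander : ∀ w → MeanderFrom 0 w ⇔ Meander w
meanderFrom0⇔meander w = mk⇔
  (All.map (λ {p} → subst (0ℤ ℤ.≤_) (ℤP.+-identityˡ (level p))))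
  (All.map (λ {p} → subst (0ℤ ℤ.≤_) (sym (ℤP.+-identityˡ (level p)))))

StartsWith : Step → List Step → Set
StartsWith y []      = ⊥
StartsWith y (x ∷ _) = x ≡ y

startsWith⇒pair : ∀ {X Y w} → StartsWith Y w → ContainsPair X Y (X ∷ w)
startsWith⇒pair {w = _ ∷ _} refl = here refl

pair-∷⁺ : ∀ {X Y} x {w} → ContainsPair X Y w → ContainsPair X Y (x ∷ w)
pair-∷⁺ x {_ ∷ _} p = there p

¬pair-∷ : ∀ {X Y x w} → (x ≡ X → ¬ StartsWith Y w) → ¬ ContainsPair X Y w → ¬ ContainsPair X Y (x ∷ w)
¬pair-∷ {w = y ∷ w} ¬start ¬pair (here refl) = ¬start refl refl
¬pair-∷ {w = y ∷ w} ¬start ¬pair (there p)   = ¬pair p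

AllowedAfter : Mode → List Step → Set
AllowedAfter free    w = ⊤
AllowedAfter blocked w = ¬ StartsWith U w

allowedAfter-∷ : ∀ c {x w} → x ≢ U → AllowedAfter c (x ∷ w)
allowedAfter-∷ free    x≢U = tt
allowedAfter-∷ blocked x≢U = x≢U

-- Admissible h c w: w can follow a prefix of height h whose last letter is recorded by c.
Admissible : ℕ → Mode → List Step → Set
Admissible h c w =
  MeanderFrom h w × ¬ ContainsPair U U w × ¬ ContainsPair D U w × AllowedAfter c w

admissible-[] : ∀ h c → Admissible h c []
admissible-[] h free    = meanderFrom-[] h , (λ ()) , (λ ()) , tt
admissible-[] h blocked = meanderFrom-[] h , (λ ()) , (λ ()) , (λ ())

admissible-∷⁺ : ∀ {h c x w h₁ c₁} → step (at h c) x ≡ at h₁ c₁ →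
                Admissible h₁ c₁ w → Admissible h c (x ∷ w)
admissible-∷⁺ {h} {c} {H} refl (m , ¬UU , ¬DU , _) =
  meanderFrom-∷⁺ (ℤP.+-identityʳ (+ h)) m , ¬pair-∷ (λ ()) ¬UU , ¬pair-∷ (λ ()) ¬DU , allowedAfter-∷ c (λ ())
admissible-∷⁺ {suc h} {c} {D} refl (m , ¬UU , ¬DU , ¬U) =
  meanderFrom-∷⁺ refl m , ¬pair-∷ (λ ()) ¬UU , ¬pair-∷ (λ _ → ¬U) ¬DU , allowedAfter-∷ c (λ ())
admissible-∷⁺ {h} {free} {U} refl (m , ¬UU , ¬DU , ¬U) =
  meanderFrom-∷⁺ (ℤP.+-comm (+ h) (+ 1)) m , ¬pair-∷ (λ _ → ¬U) ¬UU , ¬pair-∷ (λ ()) ¬DU , tt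

admissible-∷⁻ : ∀ {h c x w} → Admissible h c (x ∷ w) →
                Σ ℕ λ h₁ → Σ Mode λ c₁ → step (at h c) x ≡ at h₁ c₁ × Admissible h₁ c₁ w
admissible-∷⁻ {h} {c} {H} {w} (m , ¬UU , ¬DU , _) =
  h , free , refl , meanderFrom-∷⁻ (ℤP.+-identityʳ (+ h)) m , (λ p → ¬UU (pair-∷⁺ H p))
    , (λ p → ¬DU (pair-∷⁺ H p)) , tt
admissible-∷⁻ {zero} {c} {D} (_ ∷ () ∷ _ , _)
admissible-∷⁻ {suc h} {c} {D} (m , ¬UU , ¬DU , _) =
  h , blocked , refl , meanderFrom-∷⁻ refl m , (λ p → ¬UU (pair-∷⁺ D p)) , (λ p → ¬DU (pair-∷⁺ D p))
    , λ s → ¬DU (startsWith⇒pair s)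
admissible-∷⁻ {h} {free} {U} (m , ¬UU , ¬DU , _) =
  suc h , blocked , refl , meanderFrom-∷⁻ (ℤP.+-comm (+ h) (+ 1)) m , (λ p → ¬UU (pair-∷⁺ U p))
    , (λ p → ¬DU (pair-∷⁺ U p)) , λ s → ¬UU (startsWith⇒pair s)
admissible-∷⁻ {h} {blocked} {U} (_ , _ , _ , ¬U) = ⊥-elim (¬U refl)

admissible⇒alive : ∀ h c w → Admissible h c w → Σ ℕ λ h′ → Σ Mode λ c′ → run (at h c) w ≡ at h′ c′
admissible⇒alive h c []      _ = h , c , refl
admissible⇒alive h c (x ∷ w) a with admissible-∷⁻ {h} {c} {x} {w} a
... | h₁ , c₁ , e , a₁ rewrite e = admissible⇒alive h₁ c₁ w a₁

alive⇒admissible : ∀ h c w {h′ c′} → run (at h c) w ≡ at h′ c′ →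
                   Admissible h c w × + h ℤ.+ level w ≡ + h′
alive⇒admissible h c [] refl = admissible-[] h c , ℤP.+-identityʳ (+ h)
alive⇒admissible h c (x ∷ w) e with step (at h c) x in step≡
... | dead     = ⊥-elim (dead≢at (trans (sym (run-dead w)) e))
  where
  dead≢at : ∀ {h′ c′} → dead ≢ at h′ c′
  dead≢at ()
... | at h₁ c₁ with alive⇒admissible h₁ c₁ w e
...   | a₁ , lev = admissible-∷⁺ step≡ a₁ , (begin
  + h ℤ.+ (height x ℤ.+ level w)   ≡⟨ sym (ℤP.+-assoc (+ h) (height x) (level w)) ⟩
  + h ℤ.+ height x ℤ.+ level w     ≡⟨ cong (ℤ._+ level w) (step-height step≡) ⟩
  + h₁ ℤ.+ level w                 ≡⟨ lev ⟩
  _                                ∎)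
  where open ≡-Reasoning

start : State
start = at 0 free

inMLevel⇔final : ∀ k w → InMLevel k w ⇔ Σ Mode λ c → run start w ≡ at k c
inMLevel⇔final k w = mk⇔ to from
  where
  to : InMLevel k w → Σ Mode λ c → run start w ≡ at k c
  to ((m , ¬UU , ¬DU) , lev)
    with admissible⇒alive 0 free w (Equivalence.from (meanderFrom0⇔meander w) m , ¬UU , ¬DU , tt)
  ... | h′ , c′ , e with alive⇒admissible 0 free w e
  ...   | _ , lev′ with ℤP.+-injective (trans (sym lev′) (trans (ℤP.+-identityˡ (level w)) lev))
  ...     | refl = c′ , e
  from : (Σ Mode λ c → run start w ≡ at k c) → InMLevel k w
  from (c , e) with alive⇒admissible 0 free w e
  ... | (m , ¬UU , ¬DU , _) , lev =
    (Equivalence.to (meanderFrom0⇔meander w) m , ¬UU , ¬DU) , trans (sym (ℤP.+-identityˡ (level w))) lev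

sum-map-cong : ∀ {A : Set} {f g : A → ℕ} → (∀ x → f x ≡ g x) → ∀ xs → sum (map f xs) ≡ sum (map g xs)
sum-map-cong f≡g xs = cong sum (map-cong f≡g xs)

sum-map-+ : ∀ {A : Set} (f g : A → ℕ) xs →
            sum (map (λ x → f x ℕ.+ g x) xs) ≡ sum (map f xs) ℕ.+ sum (map g xs)
sum-map-+ f g []       = refl
sum-map-+ f g (x ∷ xs) = trans (cong (f x ℕ.+ g x ℕ.+_) (sum-map-+ f g xs))
                               (ℕInterchange.interchange (f x) (g x) (sum (map f xs)) (sum (map g xs)))

sum-map-zero : ∀ {A : Set} (xs : List A) → sum (map (λ _ → 0) xs) ≡ 0
sum-map-zero []       = refl
sum-map-zero (_ ∷ xs) = sum-map-zero xs

sum-map-swap : ∀ {A B : Set} (g : A → B → ℕ) xs ys →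
               sum (map (λ x → sum (map (g x) ys)) xs) ≡ sum (map (λ y → sum (map (λ x → g x y) xs)) ys)
sum-map-swap g []       ys = sym (sum-map-zero ys)
sum-map-swap g (x ∷ xs) ys = trans (cong (sum (map (g x) ys) ℕ.+_) (sum-map-swap g xs ys))
                                   (sym (sum-map-+ (g x) _ ys))

sum-map-concatMap : ∀ {A B : Set} (f : B → ℕ) (g : A → List B) xs →
                    sum (map f (concatMap g xs)) ≡ sum (map (λ x → sum (map f (g x))) xs)
sum-map-concatMap f g []       = refl
sum-map-concatMap f g (x ∷ xs) = begin
  sum (map f (g x ++ concatMap g xs))                  ≡⟨ cong sum (map-++ f (g x) _) ⟩
  sum (map f (g x) ++ map f (concatMap g xs))          ≡⟨ sum-++ (map f (g x)) _ ⟩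
  sum (map f (g x)) ℕ.+ sum (map f (concatMap g xs))
    ≡⟨ cong (sum (map f (g x)) ℕ.+_) (sum-map-concatMap f g xs) ⟩
  sum (map f (g x)) ℕ.+ sum (map (λ x → sum (map f (g x))) xs) ∎
  where open ≡-Reasoning

𝟙 : Bool → ℕ
𝟙 true  = 1
𝟙 false = 0

length-filter : ∀ {A : Set} {P : A → Set} (P? : Decidable P) xs →
                length (filter P? xs) ≡ sum (map (λ x → 𝟙 (does (P? x))) xs)
length-filter P? []       = refl
length-filter P? (x ∷ xs) with does (P? x)
... | true  = cong suc (length-filter P? xs)
... | false = length-filter P? xs

steps : List Step
steps = U ∷ H ∷ D ∷ []

sumSteps : (Step → ℕ) → ℕ
sumSteps g = sum (map g steps)

count : ℕ → (List Step → ℕ) → ℕ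
count n f = sum (map f (words n))

count-suc : ∀ n f → count (suc n) f ≡ sumSteps (λ x → count n (λ w → f (x ∷ w)))
count-suc n f = trans (sum-map-concatMap f (λ x → map (x ∷_) (words n)) steps)
  (sum-map-cong (λ x → cong sum (sym (map-∘ {g = f} {f = x ∷_} (words n)))) steps)

count-snoc : ∀ n f → count (suc n) f ≡ sumSteps (λ x → count n (λ w → f (w ++ [ x ])))
count-snoc zero    f = count-suc zero f
count-snoc (suc n) f = begin
  count (suc (suc n)) f
    ≡⟨ count-suc (suc n) f ⟩
  sumSteps (λ x → count (suc n) (λ w → f (x ∷ w)))
    ≡⟨ sum-map-cong (λ x → count-snoc n (λ w → f (x ∷ w))) steps ⟩
  sumSteps (λ x → sumSteps (λ y → count n (λ w → f (x ∷ w ++ [ y ]))))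
    ≡⟨ sum-map-swap (λ x y → count n (λ w → f (x ∷ w ++ [ y ]))) steps steps ⟩
  sumSteps (λ y → sumSteps (λ x → count n (λ w → f (x ∷ w ++ [ y ]))))
    ≡⟨ sum-map-cong (λ y → sym (count-suc n (λ w → f (w ++ [ y ])))) steps ⟩
  sumSteps (λ y → count (suc n) (λ w → f (w ++ [ y ]))) ∎
  where open ≡-Reasoning

isAt : State → ℕ → Mode → ℕ
isAt dead           k c       = 0
isAt (at h free)    k free    = 𝟙 (h ℕ.≡ᵇ k)
isAt (at h blocked) k blocked = 𝟙 (h ℕ.≡ᵇ k)
isAt (at h free)    k blocked = 0
isAt (at h blocked) k free    = 0

isAlive : State → ℕ → ℕ
isAlive s k = isAt s k free ℕ.+ isAt s k blocked

isAlive-at : ∀ h c k → isAlive (at h c) k ≡ 𝟙 (h ℕ.≡ᵇ k)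
isAlive-at h free    k = ℕP.+-identityʳ _
isAlive-at h blocked k = refl

inMLevel-indicator : ∀ k w (d : Dec (InMLevel k w)) → 𝟙 (does d) ≡ isAlive (run start w) k
inMLevel-indicator k w (yes p) with Equivalence.to (inMLevel⇔final k w) p
... | c , e rewrite e = sym (trans (isAlive-at k c k) (cong 𝟙 (Equivalence.to T-≡ (ℕP.≡⇒≡ᵇ k k refl))))
inMLevel-indicator k w (no ¬p) with run start w in e
... | dead   = refl
... | at h c with h ℕ.≡ᵇ k in h≡ᵇk
...   | false = sym (trans (isAlive-at h c k) (cong 𝟙 h≡ᵇk))
...   | true with ℕP.≡ᵇ⇒≡ h k (Equivalence.from T-≡ h≡ᵇk)
...     | refl = ⊥-elim (¬p (Equivalence.from (inMLevel⇔final k w) (c , e)))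

countAt : ℕ → ℕ → Mode → ℕ
countAt n k c = count n (λ w → isAt (run start w) k c)

S≡countAt : ∀ n k → S n k ≡ + (countAt n k free ℕ.+ countAt n k blocked)
S≡countAt n k = cong +_ (begin
  length (filter (inMLevel? k) (words n))         ≡⟨ length-filter (inMLevel? k) (words n) ⟩
  count n (λ w → 𝟙 (does (inMLevel? k w)))
    ≡⟨ sum-map-cong (λ w → inMLevel-indicator k w (inMLevel? k w)) (words n) ⟩
  count n (λ w → isAlive (run start w) k)         ≡⟨ sum-map-+ _ _ (words n) ⟩
  countAt n k free ℕ.+ countAt n k blocked        ∎)
  where open ≡-Reasoning

countAt-suc : ∀ n k c → countAt (suc n) k c ≡ count n (λ w → sumSteps (λ x → isAt (step (run start w) x) k c))
countAt-suc n k c = begin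
  countAt (suc n) k c
    ≡⟨ count-snoc n _ ⟩
  sumSteps (λ x → count n (λ w → isAt (run start (w ++ [ x ])) k c))
    ≡⟨ sum-map-cong (λ x → sum-map-cong (λ w → cong (λ s → isAt s k c) (run-snoc start w x)) (words n))
                    steps ⟩
  sumSteps (λ x → count n (λ w → isAt (step (run start w) x) k c))
    ≡⟨ sum-map-swap (λ x w → isAt (step (run start w) x) k c) steps (words n) ⟩
  count n (λ w → sumSteps (λ x → isAt (step (run start w) x) k c)) ∎
  where open ≡-Reasoning

incoming-free : ∀ s k → sumSteps (λ x → isAt (step s x) k free) ≡ isAlive s k
incoming-free dead              k = refl
incoming-free (at zero free)    k = refl
incoming-free (at zero blocked) k = ℕP.+-identityʳ _
incoming-free (at (suc h) free)    k = refl
incoming-free (at (suc h) blocked) k = ℕP.+-identityʳ _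

incoming-blocked-zero : ∀ s → sumSteps (λ x → isAt (step s x) 0 blocked) ≡ isAlive s 1
incoming-blocked-zero dead                 = refl
incoming-blocked-zero (at zero free)       = refl
incoming-blocked-zero (at zero blocked)    = refl
incoming-blocked-zero (at (suc h) free)    = trans (ℕP.+-identityʳ _) (sym (ℕP.+-identityʳ _))
incoming-blocked-zero (at (suc h) blocked) = ℕP.+-identityʳ _

incoming-blocked-suc : ∀ s k → sumSteps (λ x → isAt (step s x) (suc k) blocked)
                                ≡ isAt s k free ℕ.+ isAlive s (suc (suc k))
incoming-blocked-suc dead                 k = refl
incoming-blocked-suc (at zero free)       k = refl
incoming-blocked-suc (at zero blocked)    k = refl
incoming-blocked-suc (at (suc h) free)    k =
  cong (𝟙 (suc h ℕ.≡ᵇ k) ℕ.+_) (trans (ℕP.+-identityʳ _) (sym (ℕP.+-identityʳ _)))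
incoming-blocked-suc (at (suc h) blocked) k = ℕP.+-identityʳ _

countAt-free : ∀ n k → countAt (suc n) k free ≡ countAt n k free ℕ.+ countAt n k blocked
countAt-free n k = trans (countAt-suc n k free)
  (trans (sum-map-cong (λ w → incoming-free (run start w) k) (words n)) (sum-map-+ _ _ (words n)))

countAt-blocked-zero : ∀ n → countAt (suc n) 0 blocked ≡ countAt n 1 free ℕ.+ countAt n 1 blocked
countAt-blocked-zero n = trans (countAt-suc n 0 blocked)
  (trans (sum-map-cong (λ w → incoming-blocked-zero (run start w)) (words n)) (sum-map-+ _ _ (words n)))

countAt-blocked-suc : ∀ n k → countAt (suc n) (suc k) blocked
                               ≡ countAt n k free ℕ.+
                                 (countAt n (suc (suc k)) free ℕ.+ countAt n (suc (suc k)) blocked)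
countAt-blocked-suc n k = trans (countAt-suc n (suc k) blocked)
  (trans (sum-map-cong (λ w → incoming-blocked-suc (run start w) k) (words n))
    (trans (sum-map-+ _ _ (words n)) (cong (countAt n k free ℕ.+_) (sum-map-+ _ _ (words n)))))

-- Series in z and u of degree at most one in u

slice : Ser2 → ℕ → Ser1
slice G k n = G n k

*₂-slice : ∀ F G n k → (F *₂ G) n k ≡ sumTo k (λ j → (slice F j *₁ slice G (k ∸ j)) n)
*₂-slice F G n k = sumTo-swap n k (λ i j → F i j ℤ.* G (n ∸ i) (k ∸ j))

record AffineInU (F : Ser2) (a b : Ser1) : Set where
  field
    slice₀  : slice F 0 ≈₁ a
    slice₁  : slice F 1 ≈₁ b
    slice₂₊ : ∀ j n → F n (suc (suc j)) ≡ 0ℤ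

open AffineInU

module _ {F a b} (F-affine : AffineInU F a b) (G : Ser2) where

  affine-*-slice₀ : slice (F *₂ G) 0 ≈₁ a *₁ slice G 0
  affine-*-slice₀ n = trans (*₂-slice F G n 0) (*₁-cong {g = slice G 0} (slice₀ F-affine) (λ _ → refl) n)

  affine-*-sliceₛ : ∀ k → slice (F *₂ G) (suc k) ≈₁ a *₁ slice G (suc k) +₁ b *₁ slice G k
  affine-*-sliceₛ k n = trans (*₂-slice F G n (suc k)) (trans (sumTo-sucˡ k _)
    (cong₂ ℤ._+_ (*₁-cong {g = slice G (suc k)} (slice₀ F-affine) (λ _ → refl) n)
                 (trans (higher-slices k) (*₁-cong {g = slice G k} (slice₁ F-affine) (λ _ → refl) n))))
    where
    higher-slices : ∀ k → sumTo k (λ j → (slice F (suc j) *₁ slice G (k ∸ j)) n) ≡ (slice F 1 *₁ slice G k) n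
    higher-slices zero    = refl
    higher-slices (suc k) = trans (sumTo-sucˡ k _)
      (trans (cong (λ x → (slice F 1 *₁ slice G (suc k)) n ℤ.+ x)
                   (sumTo-zero k (λ j → *₁-vanishesˡ (slice G (k ∸ j)) (slice₂₊ F-affine j) n)))
             (ℤP.+-identityʳ _))

affine-resp : ∀ {F a b a′ b′} → AffineInU F a b → a ≈₁ a′ → b ≈₁ b′ → AffineInU F a′ b′
affine-resp F-affine a≈ b≈ = record
  { slice₀  = λ n → trans (slice₀ F-affine n) (a≈ n)
  ; slice₁  = λ n → trans (slice₁ F-affine n) (b≈ n)
  ; slice₂₊ = slice₂₊ F-affine }

affine-+ : ∀ {F G a b c d} → AffineInU F a b → AffineInU G c d → AffineInU (F +₂ G) (a +₁ c) (b +₁ d)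
affine-+ F-affine G-affine = record
  { slice₀  = +₁-cong (slice₀ F-affine) (slice₀ G-affine)
  ; slice₁  = +₁-cong (slice₁ F-affine) (slice₁ G-affine)
  ; slice₂₊ = λ j n → cong₂ ℤ._+_ (slice₂₊ F-affine j n) (slice₂₊ G-affine j n) }

affine-- : ∀ {F G a b c d} → AffineInU F a b → AffineInU G c d → AffineInU (F -₂ G) (a -₁ c) (b -₁ d)
affine-- F-affine G-affine = record
  { slice₀  = -₁-cong (slice₀ F-affine) (slice₀ G-affine)
  ; slice₁  = -₁-cong (slice₁ F-affine) (slice₁ G-affine)
  ; slice₂₊ = λ j n → cong₂ ℤ._-_ (slice₂₊ F-affine j n) (slice₂₊ G-affine j n) }

*₁-zero-⊎ : ∀ {f g} → f ≈₁ 0₁ ⊎ g ≈₁ 0₁ → f *₁ g ≈₁ 0₁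
*₁-zero-⊎ {g = g} (inj₁ f≈0) n = trans (*₁-cong {g = g} f≈0 (λ _ → refl) n) (*₁-zeroˡ g n)
*₁-zero-⊎ {f = f} (inj₂ g≈0) n = trans (*₁-cong {f = f} (λ _ → refl) g≈0 n) (*₁-zeroʳ f n)

affine-* : ∀ {F G a b c d} → AffineInU F a b → AffineInU G c d → b ≈₁ 0₁ ⊎ d ≈₁ 0₁ →
           AffineInU (F *₂ G) (a *₁ c) (a *₁ d +₁ b *₁ c)
affine-* {F} {G} {a} {b} {c} {d} F-affine G-affine u-free = record
  { slice₀  = λ n → trans (affine-*-slice₀ F-affine G n) (*₁-cong {f = a} (λ _ → refl) (slice₀ G-affine) n)
  ; slice₁  = λ n → trans (affine-*-sliceₛ F-affine G 0 n)
                          (+₁-cong (*₁-cong {f = a} (λ _ → refl) (slice₁ G-affine))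
                                   (*₁-cong {f = b} (λ _ → refl) (slice₀ G-affine)) n)
  ; slice₂₊ = λ j n → trans (affine-*-sliceₛ F-affine G (suc j) n)
      (cong₂ ℤ._+_ (*₁-vanishesʳ a (slice₂₊ G-affine j) n) (b-times-slice j n)) }
  where
  b-times-slice : ∀ j n → (b *₁ slice G (suc j)) n ≡ 0ℤ
  b-times-slice zero    n =
    trans (*₁-cong {f = b} (λ _ → refl) (slice₁ G-affine) n) (trans (*₁-zero-⊎ u-free n) (0₁-coeff n))
  b-times-slice (suc j) n = *₁-vanishesʳ b (slice₂₊ G-affine j) n

lift-affine : ∀ f → AffineInU (lift f) f 0₁
lift-affine f = record { slice₀ = λ _ → refl ; slice₁ = λ n → sym (0₁-coeff n) ; slice₂₊ = λ _ _ → refl }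

affine-*-lift : ∀ {F a b} → AffineInU F a b → ∀ f → AffineInU (F *₂ lift f) (a *₁ f) (a *₁ 0₁ +₁ b *₁ f)
affine-*-lift F-affine f = affine-* F-affine (lift-affine f) (inj₂ (λ _ → refl))

u-affine : AffineInU u₂ 0₁ 1₁
u-affine = record
  { slice₀  = λ { zero → refl ; (suc n) → refl }
  ; slice₁  = λ { zero → refl ; (suc n) → refl }
  ; slice₂₊ = λ { j zero → refl ; j (suc n) → refl } }

-- The generating function S

-- E = (r − z)/z².  levelGF k is the generating function of the words of level k, and
-- freeGF k, blockedGF k split it by the mode of the final state.
module LevelSeries (r : Ser1) (r-fixed : Φ r ≈₁ r) where

  E : Ser1
  E = shift (shift r)

  r≈z+z²E : r ≈₁ z₁ +₁ z₁ *₁ (z₁ *₁ E)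
  r≈z+z²E zero          = sym (r-fixed 0)
  r≈z+z²E (suc zero)    = begin
    r 1                                           ≡⟨ sym (r-fixed 1) ⟩
    1ℤ ℤ.+ (z₁ *₁ r) 1 ℤ.+ (z₁ *₁ (z₁ *₁ (r *₁ r))) 1
      ≡⟨ cong₂ (λ a b → 1ℤ ℤ.+ a ℤ.+ b) (trans (z*₁-suc r 0) (sym (r-fixed 0))) (z*₁-suc (z₁ *₁ (r *₁ r)) 0) ⟩
    1ℤ                                            ≡⟨ cong (λ x → 1ℤ ℤ.+ x) (sym (z*₁-suc (z₁ *₁ E) 0)) ⟩
    1ℤ ℤ.+ (z₁ *₁ (z₁ *₁ E)) 1                    ∎
    where open ≡-Reasoning
  r≈z+z²E (suc (suc n)) = sym (trans (ℤP.+-identityˡ _) (trans (z*₁-suc (z₁ *₁ E) (suc n)) (z*₁-suc E n)))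

  z²E≈r-z : z₁ *₁ z₁ *₁ E ≈₁ r -₁ z₁
  z²E≈r-z = ≈₁-modulo (neg₁ 1₁) r≈z+z²E (solve 3 (λ z r e →
    z :* z :* e := (r :- z) :+ (:- con 1ℤ) :* (r :- (z :+ z :* (z :* e)))) (λ _ → refl) z₁ r E)

  levelGF : ℕ → Ser1
  levelGF zero          = E
  levelGF (suc zero)    = r +₁ z₁ *₁ r *₁ E
  levelGF (suc (suc k)) = z₁ *₁ r *₁ levelGF (suc k)

  freeGF blockedGF : ℕ → Ser1
  freeGF zero      = 1₁ +₁ z₁ *₁ levelGF 0
  freeGF (suc k)   = z₁ *₁ levelGF (suc k)
  blockedGF zero    = z₁ *₁ levelGF 1
  blockedGF (suc k) = z₁ *₁ freeGF k +₁ z₁ *₁ levelGF (suc (suc k))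

  levelGF-split : ∀ k → levelGF k ≈₁ freeGF k +₁ blockedGF k
  levelGF-split zero = z*₁-cancel (z*₁-cancel
    (≈₁-modulo (neg₁ 1₁ +₁ z₁ +₁ z₁ *₁ z₁ *₁ r) r≈z+z²E
      (≈₁-modulo 1₁ (λ n → sym (r-fixed n)) (solve 3 (λ z r e →
        z :* (z :* e)
          := z :* (z :* ((con 1ℤ :+ z :* e) :+ z :* (r :+ z :* r :* e)))
             :+ (:- con 1ℤ :+ z :+ z :* z :* r) :* (r :- (z :+ z :* (z :* e)))
             :+ con 1ℤ :* (r :- (z :+ z :* r :+ z :* (z :* (r :* r))))) (λ _ → refl) z₁ r E))))
  levelGF-split (suc zero) = ≈₁-modulo (1₁ +₁ z₁ *₁ E) (λ n → sym (r-fixed n)) (solve 3 (λ z r e →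
    r :+ z :* r :* e
      := z :* (r :+ z :* r :* e) :+ (z :* (con 1ℤ :+ z :* e) :+ z :* (z :* r :* (r :+ z :* r :* e)))
         :+ (con 1ℤ :+ z :* e) :* (r :- (z :+ z :* r :+ z :* (z :* (r :* r))))) (λ _ → refl) z₁ r E)
  levelGF-split (suc (suc k)) = ≈₁-modulo (z₁ *₁ levelGF (suc k)) (λ n → sym (r-fixed n)) (solve 3 (λ z r x →
    z :* r :* x
      := z :* (z :* r :* x) :+ (z :* (z :* x) :+ z :* (z :* r :* (z :* r :* x)))
         :+ (z :* x) :* (r :- (z :+ z :* r :+ z :* (z :* (r :* r))))) (λ _ → refl) z₁ r (levelGF (suc k)))

  countAt≡coeff : ∀ n k → (+ countAt n k free ≡ freeGF k n) × (+ countAt n k blocked ≡ blockedGF k n)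
  alive≡levelGF : ∀ n k → + (countAt n k free ℕ.+ countAt n k blocked) ≡ levelGF k n

  alive≡levelGF n k = trans (cong₂ ℤ._+_ (proj₁ (countAt≡coeff n k)) (proj₂ (countAt≡coeff n k)))
                            (sym (levelGF-split k n))

  countAt≡coeff zero zero    = refl , refl
  countAt≡coeff zero (suc k) = refl , refl
  countAt≡coeff (suc n) k    = free-case k , blocked-case k
    where
    free-case : ∀ k → + countAt (suc n) k free ≡ freeGF k (suc n)
    free-case zero    = trans (cong +_ (countAt-free n 0))
      (trans (alive≡levelGF n 0) (sym (trans (ℤP.+-identityˡ _) (z*₁-suc E n))))
    free-case (suc k) = trans (cong +_ (countAt-free n (suc k)))
      (trans (alive≡levelGF n (suc k)) (sym (z*₁-suc (levelGF (suc k)) n)))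
    blocked-case : ∀ k → + countAt (suc n) k blocked ≡ blockedGF k (suc n)
    blocked-case zero    = trans (cong +_ (countAt-blocked-zero n))
      (trans (alive≡levelGF n 1) (sym (z*₁-suc (levelGF 1) n)))
    blocked-case (suc k) = trans (cong +_ (countAt-blocked-suc n k))
      (trans (cong₂ ℤ._+_ (proj₁ (countAt≡coeff n k)) (alive≡levelGF n (suc (suc k))))
             (sym (cong₂ ℤ._+_ (z*₁-suc (freeGF k) n) (z*₁-suc (levelGF (suc (suc k))) n))))

  S-slice : ∀ k → slice S k ≈₁ levelGF k
  S-slice k n = trans (S≡countAt n k) (alive≡levelGF n k)

lhs-factor-affine : ∀ r → AffineInU (z₂ *₂ z₂ *₂ (one₂ -₂ u₂ *₂ z₂ *₂ lift r))
                                    (z₁ *₁ z₁) (neg₁ (z₁ *₁ z₁ *₁ z₁ *₁ r))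
lhs-factor-affine r = affine-resp
  (affine-* (affine-*-lift (lift-affine z₁) z₁)
            (affine-- (lift-affine 1₁) (affine-*-lift (affine-*-lift u-affine z₁) r))
            (inj₁ (solve 1 (λ z → z :* con 0ℤ :+ con 0ℤ :* z := con 0ℤ) (λ _ → refl) z₁)))
  (solve 2 (λ z r → z :* z :* (con 1ℤ :- con 0ℤ :* z :* r) := z :* z) (λ _ → refl) z₁ r)
  (solve 2 (λ z r → z :* z :* (con 0ℤ :- (con 0ℤ :* z :* con 0ℤ :+ (con 0ℤ :* con 0ℤ :+ con 1ℤ :* z) :* r))
                    :+ (z :* con 0ℤ :+ con 0ℤ :* z) :* (con 1ℤ :- con 0ℤ :* z :* r)
                    := :- (z :* z :* z :* r)) (λ _ → refl) z₁ r)

rhs-affine : ∀ r → AffineInU ((one₂ +₂ u₂ *₂ z₂ *₂ z₂) *₂ lift r -₂ z₂) (r -₁ z₁) (z₁ *₁ z₁ *₁ r)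
rhs-affine r = affine-resp
  (affine-- (affine-*-lift (affine-+ (lift-affine 1₁) (affine-*-lift (affine-*-lift u-affine z₁) z₁)) r)
            (lift-affine z₁))
  (solve 2 (λ z r → (con 1ℤ :+ con 0ℤ :* z :* z) :* r :- z := r :- z) (λ _ → refl) z₁ r)
  (solve 2 (λ z r → (con 1ℤ :+ con 0ℤ :* z :* z) :* con 0ℤ
                    :+ (con 0ℤ :+ (con 0ℤ :* z :* con 0ℤ :+ (con 0ℤ :* con 0ℤ :+ con 1ℤ :* z) :* z)) :* r
                    :- con 0ℤ
                    := z :* z :* r) (λ _ → refl) z₁ r)

S-closed-form : ∀ r → Φ r ≈₁ r →
  z₂ *₂ z₂ *₂ (one₂ -₂ u₂ *₂ z₂ *₂ lift r) *₂ S ≈₂ (one₂ +₂ u₂ *₂ z₂ *₂ z₂) *₂ lift r -₂ z₂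
S-closed-form r r-fixed n k = slices-agree k n
  where
  open LevelSeries r r-fixed
  open SetoidReasoning (AlmostCommutativeRing.setoid ser-almostCommutativeRing)
  lhs = lhs-factor-affine r
  lhs-sliceₛ : ∀ k → slice (z₂ *₂ z₂ *₂ (one₂ -₂ u₂ *₂ z₂ *₂ lift r) *₂ S) (suc k)
                     ≈₁ z₁ *₁ z₁ *₁ levelGF (suc k) +₁ neg₁ (z₁ *₁ z₁ *₁ z₁ *₁ r) *₁ levelGF k
  lhs-sliceₛ k n = trans (affine-*-sliceₛ lhs S k n)
    (+₁-cong (*₁-cong {f = z₁ *₁ z₁} (λ _ → refl) (S-slice (suc k)))
             (*₁-cong {f = neg₁ (z₁ *₁ z₁ *₁ z₁ *₁ r)} (λ _ → refl) (S-slice k)) n)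
  slices-agree : ∀ k → slice (z₂ *₂ z₂ *₂ (one₂ -₂ u₂ *₂ z₂ *₂ lift r) *₂ S) k
                       ≈₁ slice ((one₂ +₂ u₂ *₂ z₂ *₂ z₂) *₂ lift r -₂ z₂) k
  slices-agree zero = begin
    _ ≈⟨ affine-*-slice₀ lhs S ⟩
    z₁ *₁ z₁ *₁ slice S 0
      ≈⟨ *₁-cong {f = z₁ *₁ z₁} (λ _ → refl) (S-slice 0) ⟩
    z₁ *₁ z₁ *₁ E
      ≈⟨ z²E≈r-z ⟩
    r -₁ z₁
      ≈⟨ (λ n → sym (slice₀ (rhs-affine r) n)) ⟩
    _ ∎
  slices-agree (suc zero) = begin
    _ ≈⟨ lhs-sliceₛ 0 ⟩
    z₁ *₁ z₁ *₁ (r +₁ z₁ *₁ r *₁ E) +₁ neg₁ (z₁ *₁ z₁ *₁ z₁ *₁ r) *₁ E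
      ≈⟨ solve 3 (λ z r e → z :* z :* (r :+ z :* r :* e) :+ (:- (z :* z :* z :* r)) :* e := z :* z :* r)
                 (λ _ → refl) z₁ r E ⟩
    z₁ *₁ z₁ *₁ r
      ≈⟨ (λ n → sym (slice₁ (rhs-affine r) n)) ⟩
    _ ∎
  slices-agree (suc (suc j)) = begin
    _ ≈⟨ lhs-sliceₛ (suc j) ⟩
    z₁ *₁ z₁ *₁ (z₁ *₁ r *₁ L) +₁ neg₁ (z₁ *₁ z₁ *₁ z₁ *₁ r) *₁ L
      ≈⟨ solve 3 (λ z r x → z :* z :* (z :* r :* x) :+ (:- (z :* z :* z :* r)) :* x := con 0ℤ)
                 (λ _ → refl) z₁ r L ⟩
    0₁
      ≈⟨ (λ n → trans (0₁-coeff n) (sym (slice₂₊ (rhs-affine r) j n))) ⟩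
    _ ∎
    where
    L = levelGF (suc j)

mainTheorem11 :
    (Σ Ser1 λ W → (W 0 ≡ 1ℤ) × (W *₁ W ≈₁ P)
        × (Σ Ser1 λ r₁ → const₁ (+ 2) *₁ z₁ *₁ z₁ *₁ r₁ ≈₁ const₁ 1ℤ -₁ z₁ -₁ W))
    × ((W r₁ : Ser1) → W 0 ≡ 1ℤ → W *₁ W ≈₁ P
        → const₁ (+ 2) *₁ z₁ *₁ z₁ *₁ r₁ ≈₁ const₁ 1ℤ -₁ z₁ -₁ W
        → z₂ *₂ z₂ *₂ (one₂ -₂ u₂ *₂ z₂ *₂ lift r₁) *₂ S
            ≈₂ (one₂ +₂ u₂ *₂ z₂ *₂ z₂) *₂ lift r₁ -₂ z₂)
mainTheorem11 = W-and-r₁-exist , λ W r₁ _ W²≈P 2z²r₁≈ → S-closed-form r₁ (W²≈P⇒Φ-fixed W r₁ W²≈P 2z²r₁≈)
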